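{- Let $v\ge 1$ and $f\in\{0,\ldots,v-1\}$ with $v-f$ even, and let $A_{v,f}$ be the block-diagonal matrix over $\mathbb{F}_2$ consisting of $\frac{v-f}{2}$ consecutive $2\times 2$ blocks $\begin{pmatrix}0&1\\1&1\end{pmatrix}$ followed by an $f\times f$ identity matrix. The action of the group $\langle A_{v,f}\rangle$ of order $3$ on the set of $1$-dimensional subspaces (points) of $\mathbb{F}_2^v$ partitions this set into (i) $2^f-1$ fixed points; (ii) $\frac{2^{v-f}-1}{3}$ orbit lines; (iii) $\frac{(2^{v-f}-1)(2^f-1)}{3}$ orbit triangles.
   Context: $\langle A_{v,f}\rangle$ acts on subspaces of $\mathbb{F}_2^v$ via $\mathbf{x}\mapsto \mathbf{x}A_{v,f}$. Each point orbit has size $1$ or $3$. An orbit of size $3$ is called an orbit line if its three points are collinear (i.e. lie in a common $2$-dimensional subspace), and an orbit triangle otherwise. -}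

module Defs where

open import Data.Bool using (Bool; true; false; _∧_; _xor_; not; if_then_else_)
open import Data.Nat using (ℕ; zero; suc; _∸_; _<ᵇ_; _≡ᵇ_; _/_; _%_)
open import Data.Fin using (Fin; toℕ)
open import Data.Vec using (Vec; []; _∷_; lookup; tabulate; replicate; zipWith; foldr; allFin; map)
open import Data.List using (List; length)
open import Data.List.Membership.Propositional using (_∈_)
open import Data.List.Relation.Unary.Unique.Propositional using (Unique)
open import Data.Product using (Σ; _×_; ∃-syntax)
open import Data.Sum using (_⊎_)
open import Relation.Binary.PropositionalEquality using (_≡_; _≢_)
open import Relation.Nullary using (¬_)
open import Function.Bundles using (_⇔_)

-- Vectors of F₂^v, with F₂ = Bool (addition = xor, multiplication = ∧).
V : ℕ → Set
V v = Vec Bool v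

0v : {v : ℕ} → V v
0v = replicate _ false

_⊕_ : {v : ℕ} → V v → V v → V v
_⊕_ = zipWith _xor_

-- Entry (i , j) of the block-diagonal matrix A_{v,f}:
-- the first v ∸ f coordinates carry (v ∸ f)/2 consecutive blocks [[0,1],[1,1]],
-- the last f coordinates carry the identity I_f.
isEven : ℕ → Bool
isEven n = n % 2 ≡ᵇ 0

entryA : (v f : ℕ) → Fin v → Fin v → Bool
entryA v f i j =
  if (toℕ i <ᵇ (v ∸ f)) ∧ (toℕ j <ᵇ (v ∸ f))
  then ((toℕ i / 2) ≡ᵇ (toℕ j / 2)) ∧ not (isEven (toℕ i) ∧ isEven (toℕ j))
  else (toℕ i ≡ᵇ toℕ j)

xorSum : {n : ℕ} → Vec Bool n → Bool
xorSum = foldr _ _xor_ false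

act : (v f : ℕ) → V v → V v
act v f x = tabulate λ j → xorSum (tabulate λ i → lookup x i ∧ entryA v f i j)

-- points (1-dimensional subspaces) of F₂^v correspond to nonzero vectors
IsPoint : {v : ℕ} → V v → Set
IsPoint x = x ≢ 0v

Fixed : (v f : ℕ) → V v → Set
Fixed v f x = act v f x ≡ x

OrbitSize3 : (v f : ℕ) → V v → Set
OrbitSize3 v f x = (x ≢ act v f x) × (x ≢ act v f (act v f x)) × (act v f x ≢ act v f (act v f x))

InSpan2 : {v : ℕ} → V v → V v → V v → Set
InSpan2 u w x = (x ≡ 0v) ⊎ (x ≡ u) ⊎ (x ≡ w) ⊎ (x ≡ u ⊕ w)

Collinear : {v : ℕ} → V v → V v → V v → Set
Collinear {v} a b c =
  ∃[ u ] ∃[ w ] ((u ≢ 0v) × (w ≢ 0v) × (u ≢ w)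
                 × InSpan2 u w a × InSpan2 u w b × InSpan2 u w c)

OrbitLine : (v f : ℕ) → V v → Set
OrbitLine v f x = OrbitSize3 v f x × Collinear x (act v f x) (act v f (act v f x))

OrbitTriangle : (v f : ℕ) → V v → Set
OrbitTriangle v f x = OrbitSize3 v f x × ¬ Collinear x (act v f x) (act v f (act v f x))

-- lexicographic order on vectors (false < true), used to pick one
-- canonical representative (the minimum) of each orbit
data _≤lex_ : {n : ℕ} → V n → V n → Set where
  []≤   : [] ≤lex []
  lt    : {n : ℕ} {x y : V n} → (false ∷ x) ≤lex (true ∷ y)
  same  : {n : ℕ} {b : Bool} {x y : V n} → x ≤lex y → (b ∷ x) ≤lex (b ∷ y)

Rep : (v f : ℕ) → V v → Set
Rep v f x = (x ≤lex act v f x) × (x ≤lex act v f (act v f x))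

HasCard : {v : ℕ} → (V v → Set) → ℕ → Set
HasCard {v} P N = ∃[ l ] (Unique l × (∀ (x : V v) → (x ∈ l) ⇔ P x) × (length l ≡ N))

-- Write v = 2m + f and x = y ++ z with y ∈ F₂^{2m}, z ∈ F₂^f. Then xA = yω ++ z, where ω acts on each
-- pair of coordinates as multiplication by a primitive cube root of unity in F₄ ≅ F₂², so ω³ = 1,
-- ω² = 1 + ω and ω has no nonzero fixed vector. Hence x is fixed iff y = 0; otherwise its orbit consists
-- of three points summing to 0 ++ z, so it is a line iff z = 0. Both kinds of orbit are thus indexed by a
-- representative y ≠ 0 together with z = 0 resp. z ≠ 0, and the representatives number (2^{2m} − 1)/3,
-- by a recursion over the blocks of y.

module Submission where

open import Defs
open import Data.Nat using (ℕ; _∸_; _^_; _*_; _<_; _≤_)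
open import Data.Nat.Divisibility using (_∣_)
open import Data.Product using (_×_; ∃-syntax)
open import Relation.Binary.PropositionalEquality using (_≡_)

open import Data.Bool using (Bool; true; false; _∧_; _xor_; not; if_then_else_; T)
open import Data.Bool.Properties using (xor-same; xor-identityˡ; xor-identityʳ; ∧-zeroʳ; ∧-identityʳ; T-∧; if-eta)
open import Data.Empty using (⊥-elim)
open import Data.Fin using (Fin; zero; suc; toℕ)
import Data.List as List
open import Data.List.Membership.Propositional using (_∈_)
import Data.List.Relation.Unary.All as All
open import Data.List.Relation.Unary.Any using (here)
open import Data.List.Membership.Propositional.Properties using (∈-map⁺; ∈-map⁻; ∈-++⁺ˡ; ∈-++⁺ʳ; ∈-++⁻)
open import Data.List.Properties using (length-++; length-map)
import Data.List.Relation.Unary.Unique.Propositional.Properties as Unique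
import Data.List.Relation.Unary.AllPairs as AllPairs
open import Data.Nat using (zero; suc; _+_; _/_; s≤s; z≤n; _<ᵇ_; _≡ᵇ_)
open import Data.Nat.Divisibility using (divides)
open import Data.Nat.DivMod using (m/n≡1+[m∸n]/n)
open import Data.Nat.Properties using (+-commutativeSemigroup; *-identityˡ; *-identityʳ; *-distribʳ-+; *-assoc; +-identityʳ; m+n∸n≡m; m+n∸m≡n; m∸n+n≡m; <⇒≤)
open import Data.Nat.Tactic.RingSolver using (solve-∀)
open import Algebra.Properties.CommutativeSemigroup +-commutativeSemigroup using (interchange)
open import Data.Product using (_,_; proj₁; proj₂)
open import Data.Product.Function.NonDependent.Propositional using (_×-⇔_)
open import Data.Sum using (inj₁; inj₂)
open import Data.Vec using (Vec; []; _∷_; _++_; lookup; tabulate; zipWith; take; drop)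
open import Data.Vec.Properties using (++-injective; ++-injectiveˡ; zipWith-++; zipWith-identityˡ; tabulate-cong; tabulate∘lookup; take++drop≡id; ∷-injectiveʳ)
open import Function using (_∘_; const)
open import Function.Bundles using (_⇔_; mk⇔; Equivalence)
import Function.Properties.Equivalence as ⇔
open import Relation.Binary.PropositionalEquality using (_≢_; refl; sym; trans; cong; cong₂; subst; module ≡-Reasoning)
open import Relation.Nullary using (¬_; contradiction)

private
  variable
    n k : ℕ

⊕-self : (x : V n) → x ⊕ x ≡ 0v
⊕-self []      = refl
⊕-self (a ∷ x) = cong₂ _∷_ (xor-same a) (⊕-self x)

0v-++ : ∀ n {k} → 0v {n} ++ 0v {k} ≡ 0v
0v-++ zero    = refl
0v-++ (suc n) = cong (false ∷_) (0v-++ n)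

++≡0v : (y : V n) {z : V k} → y ++ z ≡ 0v → y ≡ 0v × z ≡ 0v
++≡0v {n} y e = ++-injective y 0v (trans e (sym (0v-++ n)))

++-nonzeroˡ : {y : V n} {z : V k} → y ≢ 0v → y ++ z ≢ 0v
++-nonzeroˡ {y = y} y≢0 y++z≡0 = y≢0 (proj₁ (++≡0v y y++z≡0))

data PlanePoint : Set where
  p₁ p₂ p₁₂ : PlanePoint

planeBit : PlanePoint → Bool → Bool → Bool
planeBit p₁  a b = a
planeBit p₂  a b = b
planeBit p₁₂ a b = a xor b

planeVector : PlanePoint → V n → V n → V n
planeVector p = zipWith (planeBit p)

truthTable : {g : Bool → Bool → Bool} →
  g false false ≡ false → g false true ≡ false → g true false ≡ false → g true true ≡ false →
  ∀ a b → g a b ≡ false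
truthTable ff ft tf tt false false = ff
truthTable ff ft tf tt false true  = ft
truthTable ff ft tf tt true  false = tf
truthTable ff ft tf tt true  true  = tt

planeBit-distinct-sum : ∀ p q r → p ≢ q → p ≢ r → q ≢ r →
  ∀ a b → (planeBit p a b xor planeBit q a b) xor planeBit r a b ≡ false
planeBit-distinct-sum p₁  p₂  p₁₂ _ _ _ = truthTable refl refl refl refl
planeBit-distinct-sum p₁  p₁₂ p₂  _ _ _ = truthTable refl refl refl refl
planeBit-distinct-sum p₂  p₁  p₁₂ _ _ _ = truthTable refl refl refl refl
planeBit-distinct-sum p₂  p₁₂ p₁  _ _ _ = truthTable refl refl refl refl
planeBit-distinct-sum p₁₂ p₁  p₂  _ _ _ = truthTable refl refl refl refl
planeBit-distinct-sum p₁₂ p₂  p₁  _ _ _ = truthTable refl refl refl refl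
planeBit-distinct-sum p₁  p₁  _   p≢q _ _ = contradiction refl p≢q
planeBit-distinct-sum p₂  p₂  _   p≢q _ _ = contradiction refl p≢q
planeBit-distinct-sum p₁₂ p₁₂ _   p≢q _ _ = contradiction refl p≢q
planeBit-distinct-sum p₁  _   p₁  _ p≢r _ = contradiction refl p≢r
planeBit-distinct-sum p₂  _   p₂  _ p≢r _ = contradiction refl p≢r
planeBit-distinct-sum p₁₂ _   p₁₂ _ p≢r _ = contradiction refl p≢r
planeBit-distinct-sum _   p₁  p₁  _ _ q≢r = contradiction refl q≢r
planeBit-distinct-sum _   p₂  p₂  _ _ q≢r = contradiction refl q≢r
planeBit-distinct-sum _   p₁₂ p₁₂ _ _ q≢r = contradiction refl q≢r

planeVector-distinct-sum : ∀ {p q r} (u w : V n) → p ≢ q → p ≢ r → q ≢ r →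
  (planeVector p u w ⊕ planeVector q u w) ⊕ planeVector r u w ≡ 0v
planeVector-distinct-sum []      []      _   _   _   = refl
planeVector-distinct-sum {p = p} {q} {r} (a ∷ u) (b ∷ w) p≢q p≢r q≢r =
  cong₂ _∷_ (planeBit-distinct-sum p q r p≢q p≢r q≢r a b) (planeVector-distinct-sum u w p≢q p≢r q≢r)

planeVector-p₁ : (u w : V n) → planeVector p₁ u w ≡ u
planeVector-p₁ []      []      = refl
planeVector-p₁ (a ∷ u) (b ∷ w) = cong (a ∷_) (planeVector-p₁ u w)

planeVector-p₂ : (u w : V n) → planeVector p₂ u w ≡ w
planeVector-p₂ []      []      = refl
planeVector-p₂ (a ∷ u) (b ∷ w) = cong (b ∷_) (planeVector-p₂ u w)

inSpan2⇒planeVector : {u w a : V n} → InSpan2 u w a → a ≢ 0v → ∃[ p ] a ≡ planeVector p u w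
inSpan2⇒planeVector (inj₁ a≡0) a≢0 = contradiction a≡0 a≢0
inSpan2⇒planeVector {u = u} {w} (inj₂ (inj₁ a≡u)) _ = p₁ , trans a≡u (sym (planeVector-p₁ u w))
inSpan2⇒planeVector {u = u} {w} (inj₂ (inj₂ (inj₁ a≡w))) _ = p₂ , trans a≡w (sym (planeVector-p₂ u w))
inSpan2⇒planeVector (inj₂ (inj₂ (inj₂ a≡u⊕w))) _ = p₁₂ , a≡u⊕w

-- Three distinct points of a plane over F₂ are all of its points, so they sum to zero.
collinear⇒⊕≡0v : {a b c : V n} → a ≢ 0v → b ≢ 0v → c ≢ 0v → a ≢ b → a ≢ c → b ≢ c →
  Collinear a b c → (a ⊕ b) ⊕ c ≡ 0v
collinear⇒⊕≡0v a≢0 b≢0 c≢0 a≢b a≢c b≢c (u , w , _ , _ , _ , a∈ , b∈ , c∈)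
  with inSpan2⇒planeVector a∈ a≢0 | inSpan2⇒planeVector b∈ b≢0 | inSpan2⇒planeVector c∈ c≢0
... | p , refl | q , refl | r , refl =
  planeVector-distinct-sum {p = p} {q} {r} u w
    (λ { refl → a≢b refl }) (λ { refl → a≢c refl }) (λ { refl → b≢c refl })

collinear-⊕ : {a b : V n} → a ≢ 0v → b ≢ 0v → a ≢ b → Collinear a b (a ⊕ b)
collinear-⊕ {a = a} {b} a≢0 b≢0 a≢b =
  a , b , a≢0 , b≢0 , a≢b , inj₂ (inj₁ refl) , inj₂ (inj₂ (inj₁ refl)) , inj₂ (inj₂ (inj₂ refl))

HasCard-cong : {P Q : V n → Set} → (∀ x → P x ⇔ Q x) → HasCard P k → HasCard Q k
HasCard-cong P⇔Q (l , unique , mem , len) = l , unique , (λ x → ⇔.trans (mem x) (P⇔Q x)) , len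

hasCard-∷ : ∀ {n₀ n₁} {P : V (suc n) → Set} →
  HasCard (P ∘ (false ∷_)) n₀ → HasCard (P ∘ (true ∷_)) n₁ → HasCard P (n₀ + n₁)
hasCard-∷ {n = n} {n₀} {n₁} {P} (l₀ , unique₀ , mem₀ , len₀) (l₁ , unique₁ , mem₁ , len₁) =
  L₀ List.++ L₁ , Unique.++⁺ (Unique.map⁺ ∷-injectiveʳ unique₀) (Unique.map⁺ ∷-injectiveʳ unique₁) disjoint ,
  mem , length-L
  where
  L₀ L₁ : List.List (V (suc n))
  L₀ = List.map (false ∷_) l₀
  L₁ = List.map (true ∷_) l₁

  disjoint : ∀ {x} → ¬ (x ∈ L₀ × x ∈ L₁)
  disjoint (x∈L₀ , x∈L₁) with ∈-map⁻ (false ∷_) x∈L₀ | ∈-map⁻ (true ∷_) x∈L₁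
  ... | _ , _ , refl | _ , _ , ()

  ∷-∈-map : ∀ {b c} {x : V n} {l} → (b ∷ x) ∈ List.map (c ∷_) l → b ≡ c × x ∈ l
  ∷-∈-map b∷x∈ with ∈-map⁻ _ b∷x∈
  ... | _ , x∈l , refl = refl , x∈l

  to : ∀ {x} → x ∈ L₀ List.++ L₁ → P x
  to {b ∷ x} x∈ with ∈-++⁻ L₀ x∈
  ... | inj₁ x∈L₀ with ∷-∈-map x∈L₀
  ...   | refl , x∈l₀ = Equivalence.to (mem₀ x) x∈l₀
  to {b ∷ x} x∈ | inj₂ x∈L₁ with ∷-∈-map x∈L₁
  ...   | refl , x∈l₁ = Equivalence.to (mem₁ x) x∈l₁

  from : ∀ x → P x → x ∈ L₀ List.++ L₁
  from (false ∷ x) Px = ∈-++⁺ˡ (∈-map⁺ (false ∷_) (Equivalence.from (mem₀ x) Px))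
  from (true ∷ x)  Px = ∈-++⁺ʳ L₀ (∈-map⁺ (true ∷_) (Equivalence.from (mem₁ x) Px))

  mem : ∀ x → (x ∈ L₀ List.++ L₁) ⇔ P x
  mem x = mk⇔ to (from x)

  length-L : List.length (L₀ List.++ L₁) ≡ n₀ + n₁
  length-L = trans (length-++ L₀) (cong₂ _+_ (trans (length-map _ l₀) len₀) (trans (length-map _ l₁) len₁))

count : (V n → Bool) → ℕ
count {zero}  p = if p [] then 1 else 0
count {suc n} p = count (p ∘ (false ∷_)) + count (p ∘ (true ∷_))

count-hasCard : (p : V n → Bool) → HasCard (T ∘ p) (count p)
count-hasCard {zero} p with p [] in p[]≡b
... | true  = [] List.∷ List.[] , All.[] AllPairs.∷ AllPairs.[] ,
              (λ { [] → mk⇔ (const (subst T (sym p[]≡b) _)) (const (here refl)) }) , refl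
... | false = List.[] , AllPairs.[] , (λ { [] → mk⇔ (λ ()) (λ t → ⊥-elim (subst T p[]≡b t)) }) , refl
count-hasCard {suc n} p = hasCard-∷ (count-hasCard (p ∘ (false ∷_))) (count-hasCard (p ∘ (true ∷_)))

count-false : count {n} (const false) ≡ 0
count-false {zero}  = refl
count-false {suc n} = cong₂ _+_ (count-false {n}) (count-false {n})

count-true : count {n} (const true) ≡ 2 ^ n
count-true {zero}  = refl
count-true {suc n} = trans (cong₂ _+_ (count-true {n}) (count-true {n})) (cong (2 ^ n +_) (sym (+-identityʳ (2 ^ n))))

count-+-count-not : (p : V n → Bool) → count p + count (not ∘ p) ≡ 2 ^ n
count-+-count-not {zero} p with p []
... | true  = refl
... | false = refl
count-+-count-not {suc n} p = begin
  (count p⁰ + count p¹) + (count (not ∘ p⁰) + count (not ∘ p¹))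
    ≡⟨ interchange (count p⁰) (count p¹) (count (not ∘ p⁰)) (count (not ∘ p¹)) ⟩
  (count p⁰ + count (not ∘ p⁰)) + (count p¹ + count (not ∘ p¹))
    ≡⟨ cong₂ _+_ (count-+-count-not p⁰) (count-+-count-not p¹) ⟩
  2 ^ n + 2 ^ n
    ≡⟨ cong (2 ^ n +_) (sym (+-identityʳ (2 ^ n))) ⟩
  2 ^ suc n ∎
  where
  open ≡-Reasoning
  p⁰ p¹ : V n → Bool
  p⁰ = p ∘ (false ∷_)
  p¹ = p ∘ (true ∷_)

count-take-drop : ∀ d {f} (q : V d → Bool) (r : V f → Bool) →
  count (λ x → q (take d x) ∧ r (drop d x)) ≡ count q * count r
count-take-drop zero {f} q r with q []
... | true  = sym (+-identityʳ _)
... | false = count-false {f}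
count-take-drop (suc d) q r =
  trans (cong₂ _+_ (count-take-drop d (q ∘ (false ∷_)) r) (count-take-drop d (q ∘ (true ∷_)) r))
        (sym (*-distribʳ-+ (count r) (count (q ∘ (false ∷_))) (count (q ∘ (true ∷_)))))

hasCard-++ : ∀ d {f} (q : V d → Bool) (r : V f → Bool) {P : V (d + f) → Set} →
  (∀ y z → P (y ++ z) ⇔ (T (q y) × T (r z))) → HasCard P (count q * count r)
hasCard-++ d q r {P} P⇔ = subst (HasCard P) (count-take-drop d q r) (HasCard-cong split (count-hasCard _))
  where
  split : ∀ x → T (q (take d x) ∧ r (drop d x)) ⇔ P x
  split x = ⇔.trans T-∧ (⇔.trans (⇔.sym (P⇔ (take d x) (drop d x)))
                                 (mk⇔ (subst P (take++drop≡id d x)) (subst P (sym (take++drop≡id d x)))))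

isZero : V n → Bool
isZero []      = true
isZero (a ∷ x) = not a ∧ isZero x

isNonzero : V n → Bool
isNonzero = not ∘ isZero

T-isZero : (x : V n) → T (isZero x) ⇔ (x ≡ 0v)
T-isZero []          = mk⇔ (const refl) (const _)
T-isZero (false ∷ x) = ⇔.trans (T-isZero x) (mk⇔ (cong (false ∷_)) ∷-injectiveʳ)
T-isZero (true ∷ x)  = mk⇔ (λ ()) (λ ())

T-isNonzero : (x : V n) → T (isNonzero x) ⇔ (x ≢ 0v)
T-isNonzero x with isZero x | T-isZero x
... | true  | isZero⇔ = mk⇔ (λ ()) (λ x≢0 → x≢0 (Equivalence.to isZero⇔ _))
... | false | isZero⇔ = mk⇔ (λ _ → Equivalence.from isZero⇔) (const _)

count-isZero : count {n} isZero ≡ 1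
count-isZero {zero}  = refl
count-isZero {suc n} = cong₂ _+_ (count-isZero {n}) (count-false {n})

count-isNonzero : count {n} isNonzero ≡ 2 ^ n ∸ 1
count-isNonzero {n} = begin
  count {n} isNonzero                        ≡⟨ sym (m+n∸m≡n 1 (count {n} isNonzero)) ⟩
  1 + count {n} isNonzero ∸ 1                ≡⟨ cong (λ c → c + count {n} isNonzero ∸ 1) (sym (count-isZero {n})) ⟩
  count {n} isZero + count {n} isNonzero ∸ 1 ≡⟨ cong (_∸ 1) (count-+-count-not {n} isZero) ⟩
  2 ^ n ∸ 1                                  ∎
  where open ≡-Reasoning

_≤lexᵇ_ : V n → V n → Bool
[]          ≤lexᵇ []         = true
(false ∷ x) ≤lexᵇ (true ∷ y)  = true
(true ∷ x)  ≤lexᵇ (false ∷ y) = false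
(_ ∷ x)     ≤lexᵇ (_ ∷ y)     = x ≤lexᵇ y

≤lex-refl : (x : V n) → x ≤lex x
≤lex-refl []      = []≤
≤lex-refl (_ ∷ x) = same (≤lex-refl x)

∷-≤lex-∷ : ∀ {b} {x y : V n} → (b ∷ x) ≤lex (b ∷ y) ⇔ x ≤lex y
∷-≤lex-∷ = mk⇔ (λ { (same x≤y) → x≤y }) same

≤lex-++ : (y y′ : V n) (z : V k) → (y ++ z) ≤lex (y′ ++ z) ⇔ T (y ≤lexᵇ y′)
≤lex-++ []          []           z = mk⇔ (const _) (const (≤lex-refl z))
≤lex-++ (false ∷ y) (false ∷ y′) z = ⇔.trans ∷-≤lex-∷ (≤lex-++ y y′ z)
≤lex-++ (true ∷ y)  (true ∷ y′)  z = ⇔.trans ∷-≤lex-∷ (≤lex-++ y y′ z)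
≤lex-++ (false ∷ y) (true ∷ y′)  z = mk⇔ (const _) (const lt)
≤lex-++ (true ∷ y)  (false ∷ y′) z = mk⇔ (λ ()) (λ ())

twice : ℕ → ℕ
twice zero    = zero
twice (suc m) = suc (suc (twice m))

twice≡*2 : ∀ m → twice m ≡ m * 2
twice≡*2 zero    = refl
twice≡*2 (suc m) = cong (λ t → suc (suc t)) (twice≡*2 m)

ωmul : ∀ m → V (twice m) → V (twice m)
ωmul zero    []          = []
ωmul (suc m) (a ∷ b ∷ y) = b ∷ (a xor b) ∷ ωmul m y

ωmul-cube : ∀ m (y : V (twice m)) → ωmul m (ωmul m (ωmul m y)) ≡ y
ωmul-cube zero    []          = refl
ωmul-cube (suc m) (a ∷ b ∷ y) rewrite ωmul-cube m y with a | b
... | false | false = refl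
... | false | true  = refl
... | true  | false = refl
... | true  | true  = refl

ωmul-square : ∀ m (y : V (twice m)) → ωmul m (ωmul m y) ≡ y ⊕ ωmul m y
ωmul-square zero    []          = refl
ωmul-square (suc m) (a ∷ b ∷ y) = cong (λ t → (a xor b) ∷ (b xor (a xor b)) ∷ t) (ωmul-square m y)

ωmul-0v : ∀ m → ωmul m 0v ≡ 0v
ωmul-0v zero    = refl
ωmul-0v (suc m) = cong (λ t → false ∷ false ∷ t) (ωmul-0v m)

ωmul-fixed : ∀ m (y : V (twice m)) → ωmul m y ≡ y → y ≡ 0v
ωmul-fixed zero    []                  _  = refl
ωmul-fixed (suc m) (false ∷ false ∷ y) eq =
  cong (λ t → false ∷ false ∷ t) (ωmul-fixed m y (∷-injectiveʳ (∷-injectiveʳ eq)))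
ωmul-fixed (suc m) (false ∷ true ∷ y)  ()
ωmul-fixed (suc m) (true ∷ false ∷ y)  ()
ωmul-fixed (suc m) (true ∷ true ∷ y)   ()

ωmul-nonzero : ∀ m {y : V (twice m)} → y ≢ 0v → ωmul m y ≢ 0v
ωmul-nonzero m {y} y≢0 ωy≡0 = y≢0 (begin
  y                             ≡⟨ sym (ωmul-cube m y) ⟩
  ωmul m (ωmul m (ωmul m y))    ≡⟨ cong (ωmul m ∘ ωmul m) ωy≡0 ⟩
  ωmul m (ωmul m 0v)            ≡⟨ cong (ωmul m) (ωmul-0v m) ⟩
  ωmul m 0v                     ≡⟨ ωmul-0v m ⟩
  0v                            ∎)
  where open ≡-Reasoning

-- entryA v f i j is entry (v ∸ f) (toℕ i) (toℕ j); with ℕ indices the blocks can be peeled off two at a time.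
entry : ℕ → ℕ → ℕ → Bool
entry d a b =
  if (a <ᵇ d) ∧ (b <ᵇ d)
  then ((a / 2) ≡ᵇ (b / 2)) ∧ not (isEven a ∧ isEven b)
  else (a ≡ᵇ b)

[2+a]/2≡1+a/2 : ∀ a → (2 + a) / 2 ≡ suc (a / 2)
[2+a]/2≡1+a/2 a = m/n≡1+[m∸n]/n {2 + a} {2} (s≤s (s≤s z≤n))

entry-shift : ∀ d a b → entry (2 + d) (2 + a) (2 + b) ≡ entry d a b
entry-shift d a b rewrite [2+a]/2≡1+a/2 a | [2+a]/2≡1+a/2 b = refl

entry-offBlockʳ : ∀ d a {b} → b < 2 → entry (2 + d) (2 + a) b ≡ false
entry-offBlockʳ d a (s≤s z≤n)       rewrite [2+a]/2≡1+a/2 a = if-eta ((a <ᵇ d) ∧ true)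
entry-offBlockʳ d a (s≤s (s≤s z≤n)) rewrite [2+a]/2≡1+a/2 a = if-eta ((a <ᵇ d) ∧ true)

entry-offBlockˡ : ∀ d {a} b → a < 2 → entry (2 + d) a (2 + b) ≡ false
entry-offBlockˡ d b (s≤s z≤n)       rewrite [2+a]/2≡1+a/2 b = if-eta (b <ᵇ d)
entry-offBlockˡ d b (s≤s (s≤s z≤n)) rewrite [2+a]/2≡1+a/2 b = if-eta (b <ᵇ d)

dot : V n → (ℕ → Bool) → Bool
dot []      c = false
dot (a ∷ x) c = (a ∧ c 0) xor dot x (c ∘ suc)

xorSum-tabulate : (x : V n) (c : ℕ → Bool) → xorSum (tabulate λ i → lookup x i ∧ c (toℕ i)) ≡ dot x c
xorSum-tabulate []      c = refl
xorSum-tabulate (a ∷ x) c = cong ((a ∧ c 0) xor_) (xorSum-tabulate x (c ∘ suc))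

dot-cong : (x : V n) {c c′ : ℕ → Bool} → (∀ a → c a ≡ c′ a) → dot x c ≡ dot x c′
dot-cong []      c≗c′ = refl
dot-cong (a ∷ x) c≗c′ = cong₂ (λ b r → (a ∧ b) xor r) (c≗c′ 0) (dot-cong x (c≗c′ ∘ suc))

dot-vanishing : (x : V n) {c : ℕ → Bool} → (∀ a → c a ≡ false) → dot x c ≡ false
dot-vanishing x c≗0 = trans (dot-cong x c≗0) (dot-const-false x)
  where
  dot-const-false : (x : V k) → dot x (const false) ≡ false
  dot-const-false []      = refl
  dot-const-false (a ∷ x) rewrite ∧-zeroʳ a = dot-const-false x

dot-≡ᵇ : (x : V n) (j : Fin n) → dot x (_≡ᵇ toℕ j) ≡ lookup x j
dot-≡ᵇ (a ∷ x) zero    rewrite dot-vanishing x {λ a → suc a ≡ᵇ 0} (λ _ → refl) | ∧-identityʳ a = xor-identityʳ a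
dot-≡ᵇ (a ∷ x) (suc j) rewrite ∧-zeroʳ a = dot-≡ᵇ x j

column : ∀ m {f} (y : V (twice m)) (z : V f) (j : Fin (twice m + f)) →
  dot (y ++ z) (λ a → entry (twice m) a (toℕ j)) ≡ lookup (ωmul m y ++ z) j
column zero    []            z j = dot-≡ᵇ z j
column (suc m) (b₀ ∷ b₁ ∷ y) z zero
  rewrite dot-vanishing (y ++ z) (λ a → entry-offBlockʳ (twice m) a {0} (s≤s z≤n))
        | ∧-zeroʳ b₀ | ∧-identityʳ b₁ = xor-identityʳ b₁
column (suc m) (b₀ ∷ b₁ ∷ y) z (suc zero)
  rewrite dot-vanishing (y ++ z) (λ a → entry-offBlockʳ (twice m) a {1} (s≤s (s≤s z≤n)))
        | ∧-identityʳ b₀ | ∧-identityʳ b₁ | xor-identityʳ b₁ = refl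
column (suc m) (b₀ ∷ b₁ ∷ y) z (suc (suc j))
  rewrite entry-offBlockˡ (twice m) {0} (toℕ j) (s≤s z≤n)
        | entry-offBlockˡ (twice m) {1} (toℕ j) (s≤s (s≤s z≤n))
        | ∧-zeroʳ b₀ | ∧-zeroʳ b₁ =
  trans (dot-cong (y ++ z) (λ a → entry-shift (twice m) a (toℕ j))) (column m y z j)

act-++ : ∀ m f (y : V (twice m)) (z : V f) → act (twice m + f) f (y ++ z) ≡ ωmul m y ++ z
act-++ m f y z = begin
  act (twice m + f) f (y ++ z)
    ≡⟨ tabulate-cong (λ j → xorSum-tabulate (y ++ z) (λ a → entry (twice m + f ∸ f) a (toℕ j))) ⟩
  tabulate (λ j → dot (y ++ z) (λ a → entry (twice m + f ∸ f) a (toℕ j)))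
    ≡⟨ cong (λ d → tabulate (λ j → dot (y ++ z) (λ a → entry d a (toℕ j)))) (m+n∸n≡m (twice m) f) ⟩
  tabulate (λ j → dot (y ++ z) (λ a → entry (twice m) a (toℕ j)))
    ≡⟨ tabulate-cong (column m y z) ⟩
  tabulate (lookup (ωmul m y ++ z))
    ≡⟨ tabulate∘lookup (ωmul m y ++ z) ⟩
  ωmul m y ++ z ∎
  where open ≡-Reasoning

order3-orbit-distinct : {X : Set} (g : X → X) {x : X} → g (g (g x)) ≡ x → x ≢ g x →
  (x ≢ g x) × (x ≢ g (g x)) × (g x ≢ g (g x))
order3-orbit-distinct g {x} g³x≡x x≢gx = x≢gx , x≢g²x , gx≢g²x
  where
  x≢g²x : x ≢ g (g x)
  x≢g²x x≡g²x = x≢gx (sym (trans (cong g x≡g²x) g³x≡x))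
  gx≢g²x : g x ≢ g (g x)
  gx≢g²x gx≡g²x = x≢g²x (trans (sym g³x≡x) (cong g (sym gx≡g²x)))

isRep : ∀ m → V (twice m) → Bool
isRep m y = (y ≤lexᵇ ωmul m y) ∧ (y ≤lexᵇ ωmul m (ωmul m y))

module _ (m f : ℕ) (y : V (twice m)) (z : V f) where
  private
    A : V (twice m + f) → V (twice m + f)
    A = act (twice m + f) f
    x : V (twice m + f)
    x = y ++ z

  act²-++ : A (A x) ≡ ωmul m (ωmul m y) ++ z
  act²-++ = trans (cong A (act-++ m f y z)) (act-++ m f (ωmul m y) z)

  act³-++ : A (A (A x)) ≡ x
  act³-++ = trans (cong A act²-++) (trans (act-++ m f _ z) (cong (_++ z) (ωmul-cube m y)))

  fixed-++⇔ : Fixed (twice m + f) f x ⇔ (y ≡ 0v)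
  fixed-++⇔ = mk⇔ (λ Ax≡x → ωmul-fixed m y (++-injectiveˡ _ _ (trans (sym (act-++ m f y z)) Ax≡x)))
                  (λ { refl → trans (act-++ m f 0v z) (cong (_++ z) (ωmul-0v m)) })

  point-fixed-++⇔ : (IsPoint x × Fixed (twice m + f) f x) ⇔ (y ≡ 0v × z ≢ 0v)
  point-fixed-++⇔ = mk⇔
    (λ { (x≢0 , Ax≡x) → let y≡0 = Equivalence.to fixed-++⇔ Ax≡x in
                        y≡0 , λ z≡0 → x≢0 (trans (cong₂ _++_ y≡0 z≡0) (0v-++ (twice m))) })
    (λ { (y≡0 , z≢0) → (λ x≡0 → z≢0 (proj₂ (++≡0v y x≡0))) , Equivalence.from fixed-++⇔ y≡0 })

  orbitSize3-++⇔ : OrbitSize3 (twice m + f) f x ⇔ (y ≢ 0v)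
  orbitSize3-++⇔ = mk⇔
    (λ { (x≢Ax , _) y≡0 → x≢Ax (sym (Equivalence.from fixed-++⇔ y≡0)) })
    (λ y≢0 → order3-orbit-distinct A act³-++ (λ x≡Ax → y≢0 (Equivalence.to fixed-++⇔ (sym x≡Ax))))

  rep-++⇔ : Rep (twice m + f) f x ⇔ T (isRep m y)
  rep-++⇔ rewrite act²-++ | act-++ m f y z =
    ⇔.trans (≤lex-++ y (ωmul m y) z ×-⇔ ≤lex-++ y (ωmul m (ωmul m y)) z) (⇔.sym T-∧)

  orbit-sum-++ : (x ⊕ A x) ⊕ A (A x) ≡ 0v ++ z
  orbit-sum-++ = begin
    (x ⊕ A x) ⊕ A (A x)
      ≡⟨ cong₂ (λ a b → (x ⊕ a) ⊕ b) (act-++ m f y z) act²-++ ⟩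
    ((y ++ z) ⊕ (ωy ++ z)) ⊕ (ω²y ++ z)
      ≡⟨ cong (_⊕ (ω²y ++ z)) (zipWith-++ _xor_ y z ωy z) ⟩
    ((y ⊕ ωy) ++ (z ⊕ z)) ⊕ (ω²y ++ z)
      ≡⟨ zipWith-++ _xor_ (y ⊕ ωy) (z ⊕ z) ω²y z ⟩
    ((y ⊕ ωy) ⊕ ω²y) ++ ((z ⊕ z) ⊕ z)
      ≡⟨ cong₂ (λ a b → ((y ⊕ ωy) ⊕ a) ++ (b ⊕ z)) (ωmul-square m y) (⊕-self z) ⟩
    ((y ⊕ ωy) ⊕ (y ⊕ ωy)) ++ (0v ⊕ z)
      ≡⟨ cong₂ _++_ (⊕-self (y ⊕ ωy)) (zipWith-identityˡ xor-identityˡ z) ⟩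
    0v ++ z ∎
    where
    open ≡-Reasoning
    ωy ω²y : V (twice m)
    ωy  = ωmul m y
    ω²y = ωmul m ωy

  collinear-++⇔ : y ≢ 0v → Collinear x (A x) (A (A x)) ⇔ (z ≡ 0v)
  collinear-++⇔ y≢0 = mk⇔
    (λ col → proj₂ (++≡0v 0v (trans (sym orbit-sum-++)
               (collinear⇒⊕≡0v x≢0 Ax≢0 A²x≢0 x≢Ax x≢A²x Ax≢A²x col))))
    (λ z≡0 → subst (Collinear x (A x)) (sym (A²x≡x⊕Ax z≡0)) (collinear-⊕ x≢0 Ax≢0 x≢Ax))
    where
    x≢0 : x ≢ 0v
    x≢0 = ++-nonzeroˡ y≢0
    Ax≢0 : A x ≢ 0v
    Ax≢0 = subst (_≢ 0v) (sym (act-++ m f y z)) (++-nonzeroˡ (ωmul-nonzero m y≢0))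
    A²x≢0 : A (A x) ≢ 0v
    A²x≢0 = subst (_≢ 0v) (sym act²-++) (++-nonzeroˡ (ωmul-nonzero m (ωmul-nonzero m y≢0)))
    distinct : OrbitSize3 (twice m + f) f x
    distinct = Equivalence.from orbitSize3-++⇔ y≢0
    x≢Ax : x ≢ A x
    x≢Ax = proj₁ distinct
    x≢A²x : x ≢ A (A x)
    x≢A²x = proj₁ (proj₂ distinct)
    Ax≢A²x : A x ≢ A (A x)
    Ax≢A²x = proj₂ (proj₂ distinct)
    A²x≡x⊕Ax : z ≡ 0v → A (A x) ≡ x ⊕ A x
    A²x≡x⊕Ax z≡0 = begin
      A (A x)                          ≡⟨ act²-++ ⟩
      ωmul m (ωmul m y) ++ z           ≡⟨ cong₂ _++_ (ωmul-square m y) (trans z≡0 (sym (⊕-self z))) ⟩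
      (y ⊕ ωmul m y) ++ (z ⊕ z)        ≡⟨ sym (zipWith-++ _xor_ y z (ωmul m y) z) ⟩
      x ⊕ (ωmul m y ++ z)              ≡⟨ cong (x ⊕_) (sym (act-++ m f y z)) ⟩
      x ⊕ A x                          ∎
      where open ≡-Reasoning

  orbitLine-++⇔ : (IsPoint x × OrbitLine (twice m + f) f x × Rep (twice m + f) f x)
                  ⇔ ((y ≢ 0v × T (isRep m y)) × z ≡ 0v)
  orbitLine-++⇔ = mk⇔
    (λ { (_ , (size3 , col) , rep) → let y≢0 = Equivalence.to orbitSize3-++⇔ size3 in
           (y≢0 , Equivalence.to rep-++⇔ rep) , Equivalence.to (collinear-++⇔ y≢0) col })
    (λ { ((y≢0 , rep) , z≡0) →
           ++-nonzeroˡ y≢0 , (Equivalence.from orbitSize3-++⇔ y≢0 , Equivalence.from (collinear-++⇔ y≢0) z≡0) ,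
           Equivalence.from rep-++⇔ rep })

  orbitTriangle-++⇔ : (IsPoint x × OrbitTriangle (twice m + f) f x × Rep (twice m + f) f x)
                      ⇔ ((y ≢ 0v × T (isRep m y)) × z ≢ 0v)
  orbitTriangle-++⇔ = mk⇔
    (λ { (_ , (size3 , ¬col) , rep) → let y≢0 = Equivalence.to orbitSize3-++⇔ size3 in
           (y≢0 , Equivalence.to rep-++⇔ rep) , (λ z≡0 → ¬col (Equivalence.from (collinear-++⇔ y≢0) z≡0)) })
    (λ { ((y≢0 , rep) , z≢0) →
           ++-nonzeroˡ y≢0 ,
           (Equivalence.from orbitSize3-++⇔ y≢0 , (λ col → z≢0 (Equivalence.to (collinear-++⇔ y≢0) col))) ,
           Equivalence.from rep-++⇔ rep })

isNonzeroRep : ∀ m → V (twice m) → Bool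
isNonzeroRep m y = isNonzero y ∧ isRep m y

T-isNonzeroRep : ∀ m (y : V (twice m)) → T (isNonzeroRep m y) ⇔ (y ≢ 0v × T (isRep m y))
T-isNonzeroRep m y = ⇔.trans T-∧ (T-isNonzero y ×-⇔ ⇔.refl)

-- Split off the first block (a , b) of y. For (0 , 0) the representatives are those of the
-- remaining blocks; for (0 , 1) every y is one, since yω and yω² both start with 1; for (1 , 0)
-- and (1 , 1) none is, since yω resp. yω² starts with 0.
count-isNonzeroRep-suc : ∀ m → count (isNonzeroRep (suc m)) ≡ count (isNonzeroRep m) + 2 ^ twice m
count-isNonzeroRep-suc m =
  trans (cong₂ (λ t o → (count (isNonzeroRep m) + t) + (o + o)) (count-true {twice m}) (count-false {twice m}))
        (+-identityʳ _)

count-isNonzeroRep : ∀ m → 3 * count (isNonzeroRep m) + 1 ≡ 2 ^ twice m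
count-isNonzeroRep zero    = refl
count-isNonzeroRep (suc m) = begin
  3 * count (isNonzeroRep (suc m)) + 1 ≡⟨ cong (λ c → 3 * c + 1) (count-isNonzeroRep-suc m) ⟩
  3 * (R + P) + 1                      ≡⟨ regroup R P ⟩
  (3 * R + 1) + 3 * P                  ≡⟨ cong (_+ 3 * P) (count-isNonzeroRep m) ⟩
  P + 3 * P                            ≡⟨ quadruple P ⟩
  2 * (2 * P)                          ∎
  where
  open ≡-Reasoning
  R P : ℕ
  R = count (isNonzeroRep m)
  P = 2 ^ twice m
  regroup : ∀ r p → 3 * (r + p) + 1 ≡ (3 * r + 1) + 3 * p
  regroup = solve-∀
  quadruple : ∀ p → p + 3 * p ≡ 2 * (2 * p)
  quadruple = solve-∀

PointOrbitCounts : ℕ → ℕ → Set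
PointOrbitCounts v f =
  HasCard (λ x → IsPoint x × Fixed v f x) (2 ^ f ∸ 1)
  × (∃[ n ] (HasCard (λ x → IsPoint x × OrbitLine v f x × Rep v f x) n
             × (3 * n ≡ 2 ^ (v ∸ f) ∸ 1)))
  × (∃[ n ] (HasCard (λ x → IsPoint x × OrbitTriangle v f x × Rep v f x) n
             × (3 * n ≡ (2 ^ (v ∸ f) ∸ 1) * (2 ^ f ∸ 1))))

pointOrbitCounts : ∀ m f → PointOrbitCounts (twice m + f) f
pointOrbitCounts m f =
  subst (HasCard _) fixedCount
    (hasCard-++ d isZero isNonzero λ y z →
       ⇔.trans (point-fixed-++⇔ m f y z) (⇔.sym (T-isZero y ×-⇔ T-isNonzero z))) ,
  (_ , hasCard-++ d (isNonzeroRep m) isZero (λ y z →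
         ⇔.trans (orbitLine-++⇔ m f y z) (⇔.sym (T-isNonzeroRep m y ×-⇔ T-isZero z))) ,
       lineCount) ,
  (_ , hasCard-++ d (isNonzeroRep m) isNonzero (λ y z →
         ⇔.trans (orbitTriangle-++⇔ m f y z) (⇔.sym (T-isNonzeroRep m y ×-⇔ T-isNonzero z))) ,
       triangleCount)
  where
  d R : ℕ
  d = twice m
  R = count (isNonzeroRep m)

  3R≡2^[v∸f]∸1 : 3 * R ≡ 2 ^ (d + f ∸ f) ∸ 1
  3R≡2^[v∸f]∸1 = begin
    3 * R             ≡⟨ sym (m+n∸n≡m (3 * R) 1) ⟩
    3 * R + 1 ∸ 1     ≡⟨ cong (_∸ 1) (count-isNonzeroRep m) ⟩
    2 ^ d ∸ 1         ≡⟨ cong (λ e → 2 ^ e ∸ 1) (sym (m+n∸n≡m d f)) ⟩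
    2 ^ (d + f ∸ f) ∸ 1 ∎
    where open ≡-Reasoning

  fixedCount : count {d} isZero * count {f} isNonzero ≡ 2 ^ f ∸ 1
  fixedCount = trans (cong (_* count {f} isNonzero) (count-isZero {d}))
                     (trans (*-identityˡ _) (count-isNonzero {f}))

  lineCount : 3 * (R * count {f} isZero) ≡ 2 ^ (d + f ∸ f) ∸ 1
  lineCount = trans (cong (λ c → 3 * (R * c)) (count-isZero {f}))
                    (trans (cong (3 *_) (*-identityʳ R)) 3R≡2^[v∸f]∸1)

  triangleCount : 3 * (R * count {f} isNonzero) ≡ (2 ^ (d + f ∸ f) ∸ 1) * (2 ^ f ∸ 1)
  triangleCount = trans (sym (*-assoc 3 R _)) (cong₂ _*_ 3R≡2^[v∸f]∸1 (count-isNonzero {f}))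

lemma2 : (v f : ℕ) → 1 ≤ v → f < v → 2 ∣ (v ∸ f) →
    HasCard (λ x → IsPoint x × Fixed v f x) (2 ^ f ∸ 1)
    × (∃[ n ] (HasCard (λ x → IsPoint x × OrbitLine v f x × Rep v f x) n
               × (3 * n ≡ 2 ^ (v ∸ f) ∸ 1)))
    × (∃[ n ] (HasCard (λ x → IsPoint x × OrbitTriangle v f x × Rep v f x) n
               × (3 * n ≡ (2 ^ (v ∸ f) ∸ 1) * (2 ^ f ∸ 1))))
lemma2 v f _ f<v (divides m v∸f≡m*2) = subst (λ w → PointOrbitCounts w f) 2m+f≡v (pointOrbitCounts m f)
  where
  2m+f≡v : twice m + f ≡ v
  2m+f≡v = trans (cong (_+ f) (trans (twice≡*2 m) (sym v∸f≡m*2))) (m∸n+n≡m (<⇒≤ f<v))
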